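{- Let $(\mathbb{V},\star,R)$ be a modal $\mathbb{K}$-algebra. Then: (1) $\mathbb{V}^+$ is right-associative, i.e. $(\mathbb{U}\otimes\mathbb{W})\otimes\Diamond\mathbb{Z}\subseteq\mathbb{U}\otimes(\mathbb{W}\otimes\Diamond\mathbb{Z})$ for all subspaces $\mathbb{U},\mathbb{W},\mathbb{Z}$, if and only if $(\mathbb{V},\star,R)$ is pseudo right-associative: for all $u,w,z,v\in V$ with $vRz$ there exist $\alpha,\beta\in\mathbb{K}$ and $v'\in V$ with $v'R(\beta z)$ and $(u\star w)\star v=\alpha(u\star(w\star v'))$; (2) $\mathbb{V}^+$ is left-commutative, i.e. $(\mathbb{U}\otimes\mathbb{W})\otimes\Diamond\mathbb{Z}\subseteq(\mathbb{U}\otimes\Diamond\mathbb{Z})\otimes\mathbb{W}$ for all subspaces $\mathbb{U},\mathbb{W},\mathbb{Z}$, if and only if $(\mathbb{V},\star,R)$ is pseudo left-commutative: for all $u,w,z,v\in V$ with $vRz$ there exist $\alpha,\beta\in\mathbb{K}$ and $v'\in V$ with $v'R(\beta z)$ and $(u\star w)\star v=\alpha((u\star v')\star w)$.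
   Context: A $\mathbb{K}$-algebra is a vector space $\mathbb{V}$ over a field $\mathbb{K}$ with a bilinear map $\star$. A modal $\mathbb{K}$-algebra is $(\mathbb{V},\star,R)$ with $R\subseteq V\times V$ such that: (L1R) if $vRu$ and $zRw$ then for all $\gamma,\delta\in\mathbb{K}$ there are $\alpha,\beta\in\mathbb{K}$ with $(\gamma v+\delta z)R(\alpha u+\beta w)$; (L2R) if $tR(\alpha u+\beta v)$ then there exist $\lambda,\mu\in\mathbb{K}$ and $z,w$ with $zRu$, $wRv$, $\lambda z+\mu w=t$; (L3R) $xR0$ iff $x=0$. $[X]$ is the linear span of $X$. $\mathbb{V}^+$ is the set of subspaces of $\mathbb{V}$ with $\mathbb{U}\otimes\mathbb{W}:=[u\star w\mid u\in\mathbb{U},w\in\mathbb{W}]$ and $\Diamond\mathbb{U}:=[v\mid\exists u\in\mathbb{U}\ vRu]$. -}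

module Defs where

open import Level using (Level; _⊔_; suc)
open import Algebra.Bundles using (CommutativeRing)
open import Algebra.Module.Bundles using (Module)
open import Data.Product using (Σ; ∃; _×_)
open import Relation.Nullary using (¬_)
open import Function.Bundles using (_⇔_)

record Field (c ℓ : Level) : Set (suc (c ⊔ ℓ)) where
  field
    commutativeRing : CommutativeRing c ℓ
  open CommutativeRing commutativeRing public
  field
    0≉1     : ¬ (0# ≈ 1#)
    inverse : ∀ x → ¬ (x ≈ 0#) → ∃ λ y → x * y ≈ 1#

record KAlgebra {c ℓ : Level} (K : Field c ℓ) (m ℓm : Level)
       : Set (c ⊔ ℓ ⊔ suc (m ⊔ ℓm)) where
  open Field K
  field
    vectorSpace : Module commutativeRing m ℓm
  open Module vectorSpace public
  infixl 7 _⋆_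
  field
    _⋆_    : Carrierᴹ → Carrierᴹ → Carrierᴹ
    ⋆-cong : ∀ {x x′ y y′} → x ≈ᴹ x′ → y ≈ᴹ y′ → (x ⋆ y) ≈ᴹ (x′ ⋆ y′)
    ⋆-+ˡ   : ∀ x y z → ((x +ᴹ y) ⋆ z) ≈ᴹ ((x ⋆ z) +ᴹ (y ⋆ z))
    ⋆-+ʳ   : ∀ x y z → (x ⋆ (y +ᴹ z)) ≈ᴹ ((x ⋆ y) +ᴹ (x ⋆ z))
    ⋆-*ˡ   : ∀ a x y → ((a *ₗ x) ⋆ y) ≈ᴹ (a *ₗ (x ⋆ y))
    ⋆-*ʳ   : ∀ a x y → (x ⋆ (a *ₗ y)) ≈ᴹ (a *ₗ (x ⋆ y))

-- A modal K-algebra (V, ⋆, R) satisfying (L1R), (L2R), (L3R).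
-- Since V carries a setoid equality, R is required to respect it.
record ModalAlgebra {c ℓ : Level} (K : Field c ℓ) (m ℓm ℓR : Level)
       : Set (c ⊔ ℓ ⊔ suc (m ⊔ ℓm ⊔ ℓR)) where
  open Field K using () renaming (Carrier to Scalar)
  field
    algebra : KAlgebra K m ℓm
  open KAlgebra algebra public
  field
    R      : Carrierᴹ → Carrierᴹ → Set ℓR
    R-resp : ∀ {x x′ y y′} → x ≈ᴹ x′ → y ≈ᴹ y′ → R x y → R x′ y′
    L1R : ∀ {v u z w} → R v u → R z w → ∀ (γ δ : Scalar) →
          Σ Scalar λ α → Σ Scalar λ β →
            R ((γ *ₗ v) +ᴹ (δ *ₗ z)) ((α *ₗ u) +ᴹ (β *ₗ w))
    L2R : ∀ {t u v} (α β : Scalar) → R t ((α *ₗ u) +ᴹ (β *ₗ v)) →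
          Σ Scalar λ λ′ → Σ Scalar λ μ → Σ Carrierᴹ λ z → Σ Carrierᴹ λ w →
            R z u × R w v × ((λ′ *ₗ z) +ᴹ (μ *ₗ w)) ≈ᴹ t
    L3R : ∀ x → (R x 0ᴹ ⇔ x ≈ᴹ 0ᴹ)

module _ {c ℓ m ℓm ℓR : Level} {K : Field c ℓ} (A : ModalAlgebra K m ℓm ℓR) where
  open Field K using () renaming (Carrier to Scalar)
  open ModalAlgebra A

  Lv : Level
  Lv = c ⊔ ℓ ⊔ m ⊔ ℓm ⊔ ℓR

  Pred : Set (m ⊔ suc Lv)
  Pred = Carrierᴹ → Set Lv

  record Subspace : Set (m ⊔ suc Lv) where
    field
      _∈_    : Pred
      ∈-resp : ∀ {x y} → x ≈ᴹ y → _∈_ x → _∈_ y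
      ∈-0    : _∈_ 0ᴹ
      ∈-+    : ∀ {x y} → _∈_ x → _∈_ y → _∈_ (x +ᴹ y)
      ∈-*    : ∀ a {x} → _∈_ x → _∈_ (a *ₗ x)

  data Span (X : Pred) : Pred where
    base  : ∀ {x} → X x → Span X x
    zero  : Span X 0ᴹ
    add   : ∀ {x y} → Span X x → Span X y → Span X (x +ᴹ y)
    scale : ∀ a {x} → Span X x → Span X (a *ₗ x)
    resp  : ∀ {x y} → x ≈ᴹ y → Span X x → Span X y

  _⊆_ : Pred → Pred → Set (m ⊔ Lv)
  P ⊆ Q = ∀ x → P x → Q x

  _⊗_ : Pred → Pred → Pred
  U ⊗ W = Span (λ x → Σ Carrierᴹ λ u → Σ Carrierᴹ λ w → U u × W w × x ≈ᴹ (u ⋆ w))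

  ◇ : Pred → Pred
  ◇ U = Span (λ v → Σ Carrierᴹ λ u → U u × R v u)

  RightAssociative⁺ : Set (m ⊔ suc Lv)
  RightAssociative⁺ = ∀ (U W Z : Subspace) → let open Subspace in
    ((_∈_ U ⊗ _∈_ W) ⊗ ◇ (_∈_ Z)) ⊆ (_∈_ U ⊗ (_∈_ W ⊗ ◇ (_∈_ Z)))

  LeftCommutative⁺ : Set (m ⊔ suc Lv)
  LeftCommutative⁺ = ∀ (U W Z : Subspace) → let open Subspace in
    ((_∈_ U ⊗ _∈_ W) ⊗ ◇ (_∈_ Z)) ⊆ ((_∈_ U ⊗ ◇ (_∈_ Z)) ⊗ _∈_ W)

  PseudoRightAssociative : Set (c ⊔ m ⊔ ℓm ⊔ ℓR)
  PseudoRightAssociative = ∀ u w z v → R v z →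
    Σ Scalar λ α → Σ Scalar λ β → Σ Carrierᴹ λ v′ →
      R v′ (β *ₗ z) × ((u ⋆ w) ⋆ v) ≈ᴹ (α *ₗ (u ⋆ (w ⋆ v′)))

  PseudoLeftCommutative : Set (c ⊔ m ⊔ ℓm ⊔ ℓR)
  PseudoLeftCommutative = ∀ u w z v → R v z →
    Σ Scalar λ α → Σ Scalar λ β → Σ Carrierᴹ λ v′ →
      R v′ (β *ₗ z) × ((u ⋆ w) ⋆ v) ≈ᴹ (α *ₗ ((u ⋆ v′) ⋆ w))

-- Taking U, W, Z to be the lines spanned by single vectors u, w, z turns either inclusion
-- into the corresponding pseudo-law: ◇[z] consists of vectors v′ with v′ R βz (closure of
-- this set under linear combinations is L1R, and 0 belongs to it by L3R), and the elements
-- of [u] ⊗ P are the u ⋆ p with p ∈ P. Conversely both sides of each inclusion are spans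
-- and ⋆ is bilinear, so it suffices to check generators (u ⋆ w) ⋆ v with v R z, z ∈ Z,
-- and for these the pseudo-law exhibits the required element.
module Submission where

open import Defs
open import Level using (Level; Lift; lift; _⊔_)
open import Data.Product using (_×_; Σ; _,_)
open import Function.Bundles using (_⇔_; mk⇔; Equivalence)
import Relation.Binary.Reasoning.Setoid as SetoidReasoning

module ModalAlgebraProperties
  {c ℓ m ℓm ℓR : Level} {K : Field c ℓ} (A : ModalAlgebra K m ℓm ℓR) where

  open Field K using (_+_; _*_; 0#; 1#) renaming (Carrier to Scalar; refl to ≈-refl)
  open ModalAlgebra A
  open SetoidReasoning ≈ᴹ-setoid

  record IsSubspace {p} (P : Carrierᴹ → Set p) : Set (c ⊔ m ⊔ ℓm ⊔ p) where
    field
      ≈-closed  : ∀ {x y} → x ≈ᴹ y → P x → P y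
      0-closed  : P 0ᴹ
      +-closed  : ∀ {x y} → P x → P y → P (x +ᴹ y)
      *ₗ-closed : ∀ a {x} → P x → P (a *ₗ x)
  open IsSubspace

  Span-isSubspace : (X : Pred A) → IsSubspace (Span A X)
  Span-isSubspace X = record
    { ≈-closed = resp ; 0-closed = zero ; +-closed = add ; *ₗ-closed = scale }

  Span-minimal : ∀ {p} {X : Pred A} {P : Carrierᴹ → Set p} → IsSubspace P →
                 (∀ x → X x → P x) → ∀ x → Span A X x → P x
  Span-minimal sP X⊆P x (base Xx)   = X⊆P x Xx
  Span-minimal sP X⊆P _ zero        = 0-closed sP
  Span-minimal sP X⊆P _ (add s t)   =
    +-closed sP (Span-minimal sP X⊆P _ s) (Span-minimal sP X⊆P _ t)
  Span-minimal sP X⊆P _ (scale a s) = *ₗ-closed sP a (Span-minimal sP X⊆P _ s)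
  Span-minimal sP X⊆P _ (resp e s)  = ≈-closed sP e (Span-minimal sP X⊆P _ s)

  ⋆-zeroˡ : ∀ x → (0ᴹ ⋆ x) ≈ᴹ 0ᴹ
  ⋆-zeroˡ x = begin
    0ᴹ ⋆ x         ≈⟨ ⋆-cong (≈ᴹ-sym (*ₗ-zeroˡ 0ᴹ)) ≈ᴹ-refl ⟩
    (0# *ₗ 0ᴹ) ⋆ x ≈⟨ ⋆-*ˡ 0# 0ᴹ x ⟩
    0# *ₗ (0ᴹ ⋆ x) ≈⟨ *ₗ-zeroˡ _ ⟩
    0ᴹ             ∎

  ⋆-zeroʳ : ∀ x → (x ⋆ 0ᴹ) ≈ᴹ 0ᴹ
  ⋆-zeroʳ x = begin
    x ⋆ 0ᴹ         ≈⟨ ⋆-cong ≈ᴹ-refl (≈ᴹ-sym (*ₗ-zeroˡ 0ᴹ)) ⟩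
    x ⋆ (0# *ₗ 0ᴹ) ≈⟨ ⋆-*ʳ 0# x 0ᴹ ⟩
    0# *ₗ (x ⋆ 0ᴹ) ≈⟨ *ₗ-zeroˡ _ ⟩
    0ᴹ             ∎

  LeftMultiples : ∀ {p} → Carrierᴹ → (Carrierᴹ → Set p) → Carrierᴹ → Set (m ⊔ ℓm ⊔ p)
  LeftMultiples u P x = Σ Carrierᴹ λ y → P y × x ≈ᴹ (u ⋆ y)

  RightMultiples : ∀ {p} → (Carrierᴹ → Set p) → Carrierᴹ → Carrierᴹ → Set (m ⊔ ℓm ⊔ p)
  RightMultiples P w x = Σ Carrierᴹ λ y → P y × x ≈ᴹ (y ⋆ w)

  LeftMultiples-isSubspace : ∀ {p} u {P : Carrierᴹ → Set p} →
                             IsSubspace P → IsSubspace (LeftMultiples u P)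
  LeftMultiples-isSubspace u sP = record
    { ≈-closed  = λ { e (y , Py , x≈) → y , Py , ≈ᴹ-trans (≈ᴹ-sym e) x≈ }
    ; 0-closed  = 0ᴹ , 0-closed sP , ≈ᴹ-sym (⋆-zeroʳ u)
    ; +-closed  = λ { (y , Py , x≈) (y′ , Py′ , x′≈) →
        y +ᴹ y′ , +-closed sP Py Py′ , ≈ᴹ-trans (+ᴹ-cong x≈ x′≈) (≈ᴹ-sym (⋆-+ʳ u y y′)) }
    ; *ₗ-closed = λ { a (y , Py , x≈) →
        a *ₗ y , *ₗ-closed sP a Py , ≈ᴹ-trans (*ₗ-cong ≈-refl x≈) (≈ᴹ-sym (⋆-*ʳ a u y)) }
    }

  RightMultiples-isSubspace : ∀ {p} w {P : Carrierᴹ → Set p} →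
                              IsSubspace P → IsSubspace (RightMultiples P w)
  RightMultiples-isSubspace w sP = record
    { ≈-closed  = λ { e (y , Py , x≈) → y , Py , ≈ᴹ-trans (≈ᴹ-sym e) x≈ }
    ; 0-closed  = 0ᴹ , 0-closed sP , ≈ᴹ-sym (⋆-zeroˡ w)
    ; +-closed  = λ { (y , Py , x≈) (y′ , Py′ , x′≈) →
        y +ᴹ y′ , +-closed sP Py Py′ , ≈ᴹ-trans (+ᴹ-cong x≈ x′≈) (≈ᴹ-sym (⋆-+ˡ y y′ w)) }
    ; *ₗ-closed = λ { a (y , Py , x≈) →
        a *ₗ y , *ₗ-closed sP a Py , ≈ᴹ-trans (*ₗ-cong ≈-refl x≈) (≈ᴹ-sym (⋆-*ˡ a y w)) }
    }

  ⋆-Span : ∀ {p} {X Y : Pred A} {T : Carrierᴹ → Set p} → IsSubspace T →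
           (∀ x y → X x → Y y → T (x ⋆ y)) →
           ∀ x y → Span A X x → Span A Y y → T (x ⋆ y)
  ⋆-Span {T = T} sT XY⊆T x y Sx Sy =
    Span-minimal leftFactors
      (λ x Xx → Span-minimal (rightFactors x) (λ y Yy → XY⊆T x y Xx Yy) y Sy) x Sx
    where
    rightFactors : ∀ x → IsSubspace (λ y → T (x ⋆ y))
    rightFactors x = record
      { ≈-closed  = λ e → ≈-closed sT (⋆-cong ≈ᴹ-refl e)
      ; 0-closed  = ≈-closed sT (≈ᴹ-sym (⋆-zeroʳ x)) (0-closed sT)
      ; +-closed  = λ Ty Ty′ →
          ≈-closed sT (≈ᴹ-sym (⋆-+ʳ x _ _)) (+-closed sT Ty Ty′)
      ; *ₗ-closed = λ a Ty → ≈-closed sT (≈ᴹ-sym (⋆-*ʳ a x _)) (*ₗ-closed sT a Ty)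
      }
    leftFactors : IsSubspace (λ x → T (x ⋆ y))
    leftFactors = record
      { ≈-closed  = λ e → ≈-closed sT (⋆-cong e ≈ᴹ-refl)
      ; 0-closed  = ≈-closed sT (≈ᴹ-sym (⋆-zeroˡ y)) (0-closed sT)
      ; +-closed  = λ Tx Tx′ →
          ≈-closed sT (≈ᴹ-sym (⋆-+ˡ _ _ y)) (+-closed sT Tx Tx′)
      ; *ₗ-closed = λ a Tx → ≈-closed sT (≈ᴹ-sym (⋆-*ˡ a _ y)) (*ₗ-closed sT a Tx)
      }

  ⊗◇-minimal : ∀ {p} (U W Z : Pred A) {T : Carrierᴹ → Set p} → IsSubspace T →
               (∀ u w z v → U u → W w → Z z → R v z → T ((u ⋆ w) ⋆ v)) →
               ∀ x → _⊗_ A (_⊗_ A U W) (◇ A Z) x → T x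
  ⊗◇-minimal U W Z {T} sT gen = Span-minimal sT λ
    { x (y , v , UWy , ◇Zv , x≈) →
        ≈-closed sT (≈ᴹ-sym x≈) (⋆-Span sT onGenerators y v UWy ◇Zv) }
    where
    onGenerators : ∀ y v → (Σ Carrierᴹ λ u → Σ Carrierᴹ λ w → U u × W w × y ≈ᴹ (u ⋆ w)) →
                   (Σ Carrierᴹ λ z → Z z × R v z) → T (y ⋆ v)
    onGenerators y v (u , w , Uu , Ww , y≈) (z , Zz , vRz) =
      ≈-closed sT (⋆-cong (≈ᴹ-sym y≈) ≈ᴹ-refl) (gen u w z v Uu Ww Zz vRz)

  Line : Carrierᴹ → Pred A
  Line u x = Lift (Lv A) (Σ Scalar λ a → x ≈ᴹ a *ₗ u)

  ⟨_⟩ : Carrierᴹ → Subspace A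
  ⟨ u ⟩ = record
    { _∈_    = Line u
    ; ∈-resp = λ { e (lift (a , x≈)) → lift (a , ≈ᴹ-trans (≈ᴹ-sym e) x≈) }
    ; ∈-0    = lift (0# , ≈ᴹ-sym (*ₗ-zeroˡ u))
    ; ∈-+    = λ { (lift (a , x≈)) (lift (b , y≈)) →
        lift (a + b , ≈ᴹ-trans (+ᴹ-cong x≈ y≈) (≈ᴹ-sym (*ₗ-distribʳ u a b))) }
    ; ∈-*    = λ { s (lift (a , x≈)) →
        lift (s * a , ≈ᴹ-trans (*ₗ-cong ≈-refl x≈) (≈ᴹ-sym (*ₗ-assoc s a u))) }
    }

  Line-self : ∀ u → Line u u
  Line-self u = lift (1# , ≈ᴹ-sym (*ₗ-identityˡ u))

  Line⊗⊆LeftMultiples : ∀ {p} u (Q : Pred A) {P : Carrierᴹ → Set p} → IsSubspace P →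
                        (∀ x → Q x → P x) →
                        ∀ x → _⊗_ A (Line u) Q x → LeftMultiples u P x
  Line⊗⊆LeftMultiples u Q sP Q⊆P = Span-minimal (LeftMultiples-isSubspace u sP)
    λ { x (y , q , lift (s , y≈) , Qq , x≈) → s *ₗ q , *ₗ-closed sP s (Q⊆P q Qq) , (begin
          x            ≈⟨ x≈ ⟩
          y ⋆ q        ≈⟨ ⋆-cong y≈ ≈ᴹ-refl ⟩
          (s *ₗ u) ⋆ q ≈⟨ ⋆-*ˡ s u q ⟩
          s *ₗ (u ⋆ q) ≈˘⟨ ⋆-*ʳ s u q ⟩
          u ⋆ (s *ₗ q) ∎) }

  ⊗Line⊆RightMultiples : ∀ {p} w (Q : Pred A) {P : Carrierᴹ → Set p} → IsSubspace P →
                         (∀ x → Q x → P x) →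
                         ∀ x → _⊗_ A Q (Line w) x → RightMultiples P w x
  ⊗Line⊆RightMultiples w Q sP Q⊆P = Span-minimal (RightMultiples-isSubspace w sP)
    λ { x (q , y , Qq , lift (s , y≈) , x≈) → s *ₗ q , *ₗ-closed sP s (Q⊆P q Qq) , (begin
          x            ≈⟨ x≈ ⟩
          q ⋆ y        ≈⟨ ⋆-cong ≈ᴹ-refl y≈ ⟩
          q ⋆ (s *ₗ w) ≈⟨ ⋆-*ʳ s q w ⟩
          s *ₗ (q ⋆ w) ≈˘⟨ ⋆-*ˡ s q w ⟩
          (s *ₗ q) ⋆ w ∎) }

  RelatedToMultiple : Carrierᴹ → Carrierᴹ → Set (c ⊔ ℓR)
  RelatedToMultiple z x = Σ Scalar λ β → R x (β *ₗ z)

  RelatedToMultiple-isSubspace : ∀ z → IsSubspace (RelatedToMultiple z)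
  RelatedToMultiple-isSubspace z = record
    { ≈-closed  = λ { e (β , xR) → β , R-resp e ≈ᴹ-refl xR }
    ; 0-closed  = 0# , R-resp ≈ᴹ-refl (≈ᴹ-sym (*ₗ-zeroˡ z)) (Equivalence.from (L3R 0ᴹ) ≈ᴹ-refl)
    ; +-closed  = +-closed′
    ; *ₗ-closed = *ₗ-closed′
    }
    where
    combine : ∀ α β β₁ β₂ →
              ((α *ₗ (β₁ *ₗ z)) +ᴹ (β *ₗ (β₂ *ₗ z))) ≈ᴹ ((α * β₁ + β * β₂) *ₗ z)
    combine α β β₁ β₂ = begin
      (α *ₗ (β₁ *ₗ z)) +ᴹ (β *ₗ (β₂ *ₗ z)) ≈˘⟨ +ᴹ-cong (*ₗ-assoc α β₁ z) (*ₗ-assoc β β₂ z) ⟩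
      ((α * β₁) *ₗ z) +ᴹ ((β * β₂) *ₗ z)   ≈˘⟨ *ₗ-distribʳ z _ _ ⟩
      (α * β₁ + β * β₂) *ₗ z               ∎
    +-closed′ : ∀ {x y} → RelatedToMultiple z x → RelatedToMultiple z y →
                RelatedToMultiple z (x +ᴹ y)
    +-closed′ {x} {y} (β₁ , xR) (β₂ , yR) =
      let α , β , sumR = L1R xR yR 1# 1#
      in α * β₁ + β * β₂ ,
         R-resp (+ᴹ-cong (*ₗ-identityˡ x) (*ₗ-identityˡ y)) (combine α β β₁ β₂) sumR
    *ₗ-closed′ : ∀ a {x} → RelatedToMultiple z x → RelatedToMultiple z (a *ₗ x)
    *ₗ-closed′ a {x} (β₁ , xR) =
      let α , β , sumR = L1R xR xR a 0#
      in α * β₁ + β * β₁ ,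
         R-resp (≈ᴹ-trans (+ᴹ-cong ≈ᴹ-refl (*ₗ-zeroˡ x)) (+ᴹ-identityʳ _))
                (combine α β β₁ β₁) sumR

  ◇Line⊆RelatedToMultiple : ∀ z x → ◇ A (Line z) x → RelatedToMultiple z x
  ◇Line⊆RelatedToMultiple z = Span-minimal (RelatedToMultiple-isSubspace z)
    λ { x (y , lift (β , y≈) , xRy) → β , R-resp ≈ᴹ-refl y≈ xRy }

  ⋆⋆-∈-Line⊗Line⊗◇Line : ∀ u w z v → R v z →
                          _⊗_ A (_⊗_ A (Line u) (Line w)) (◇ A (Line z)) ((u ⋆ w) ⋆ v)
  ⋆⋆-∈-Line⊗Line⊗◇Line u w z v vRz = base
    ( u ⋆ w , v
    , base (u , w , Line-self u , Line-self w , ≈ᴹ-refl)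
    , base (z , Line-self z , vRz)
    , ≈ᴹ-refl )

  rightAssociative⁺⇒pseudo : RightAssociative⁺ A → PseudoRightAssociative A
  rightAssociative⁺⇒pseudo H u w z v vRz =
    let y , (v′ , (β , v′R) , y≈) , x≈ =
          decompose _ (H ⟨ u ⟩ ⟨ w ⟩ ⟨ z ⟩ _ (⋆⋆-∈-Line⊗Line⊗◇Line u w z v vRz))
    in 1# , β , v′ , v′R , (begin
        (u ⋆ w) ⋆ v          ≈⟨ x≈ ⟩
        u ⋆ y                ≈⟨ ⋆-cong ≈ᴹ-refl y≈ ⟩
        u ⋆ (w ⋆ v′)         ≈˘⟨ *ₗ-identityˡ _ ⟩
        1# *ₗ (u ⋆ (w ⋆ v′)) ∎)
    where
    sRz = RelatedToMultiple-isSubspace z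
    decompose : ∀ x → _⊗_ A (Line u) (_⊗_ A (Line w) (◇ A (Line z))) x →
                LeftMultiples u (LeftMultiples w (RelatedToMultiple z)) x
    decompose = Line⊗⊆LeftMultiples u _ (LeftMultiples-isSubspace w sRz)
                  (Line⊗⊆LeftMultiples w _ sRz (◇Line⊆RelatedToMultiple z))

  leftCommutative⁺⇒pseudo : LeftCommutative⁺ A → PseudoLeftCommutative A
  leftCommutative⁺⇒pseudo H u w z v vRz =
    let y , (v′ , (β , v′R) , y≈) , x≈ =
          decompose _ (H ⟨ u ⟩ ⟨ w ⟩ ⟨ z ⟩ _ (⋆⋆-∈-Line⊗Line⊗◇Line u w z v vRz))
    in 1# , β , v′ , v′R , (begin
        (u ⋆ w) ⋆ v          ≈⟨ x≈ ⟩
        y ⋆ w                ≈⟨ ⋆-cong y≈ ≈ᴹ-refl ⟩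
        (u ⋆ v′) ⋆ w         ≈˘⟨ *ₗ-identityˡ _ ⟩
        1# *ₗ ((u ⋆ v′) ⋆ w) ∎)
    where
    sRz = RelatedToMultiple-isSubspace z
    decompose : ∀ x → _⊗_ A (_⊗_ A (Line u) (◇ A (Line z))) (Line w) x →
                RightMultiples (LeftMultiples u (RelatedToMultiple z)) w x
    decompose = ⊗Line⊆RightMultiples w _ (LeftMultiples-isSubspace u sRz)
                  (Line⊗⊆LeftMultiples u _ sRz (◇Line⊆RelatedToMultiple z))

  pseudo⇒rightAssociative⁺ : PseudoRightAssociative A → RightAssociative⁺ A
  pseudo⇒rightAssociative⁺ P U W Z =
    ⊗◇-minimal _ _ _ (Span-isSubspace _) λ u w z v Uu Ww Zz vRz →
      let α , β , v′ , v′R , x≈ = P u w z v vRz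
          ◇Zv′ = base (β *ₗ z , Subspace.∈-* Z β Zz , v′R)
          w⋆v′ = base (w , v′ , Ww , ◇Zv′ , ≈ᴹ-refl)
      in resp (≈ᴹ-sym x≈) (scale α (base (u , w ⋆ v′ , Uu , w⋆v′ , ≈ᴹ-refl)))

  pseudo⇒leftCommutative⁺ : PseudoLeftCommutative A → LeftCommutative⁺ A
  pseudo⇒leftCommutative⁺ P U W Z =
    ⊗◇-minimal _ _ _ (Span-isSubspace _) λ u w z v Uu Ww Zz vRz →
      let α , β , v′ , v′R , x≈ = P u w z v vRz
          ◇Zv′ = base (β *ₗ z , Subspace.∈-* Z β Zz , v′R)
          u⋆v′ = base (u , v′ , Uu , ◇Zv′ , ≈ᴹ-refl)
      in resp (≈ᴹ-sym x≈) (scale α (base (u ⋆ v′ , w , u⋆v′ , Ww , ≈ᴹ-refl)))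

mainTheorem10 : ∀ {c ℓ m ℓm ℓR : Level} {K : Field c ℓ} (A : ModalAlgebra K m ℓm ℓR) →
      (RightAssociative⁺ A ⇔ PseudoRightAssociative A)
    × (LeftCommutative⁺ A ⇔ PseudoLeftCommutative A)
mainTheorem10 A =
    mk⇔ rightAssociative⁺⇒pseudo pseudo⇒rightAssociative⁺
  , mk⇔ leftCommutative⁺⇒pseudo pseudo⇒leftCommutative⁺
  where open ModalAlgebraProperties A
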